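{- Let $\mathcal C$ be a well-formed CCCP configuration such that there is no configuration $\mathcal C'$ with $\mathcal C\to_i\mathcal C'$. Then $\mathcal C\to_\sigma\mathcal C''$ for some configuration $\mathcal C''$.
   Context: The calculus CCCP. Fix a set of channels ranged over by $c,d$, and a set of values containing data variables $x,y$ and a distinguished error value $\mathtt{err}$; every closed value $v$ has a transmission time $\delta_v$, a positive integer. Expressions $e$ are built from values, with an evaluation map $[\![\cdot]\!]$ sending variable-free expressions to closed values; Boolean expressions $b$ are $e_1=e_2$ or $\mathrm{exp}(c)$. Processes: $P,Q ::= c!\langle e\rangle.P \mid \lfloor c?(x).P\rfloor Q \mid \sigma.P \mid \tau.P \mid P+Q \mid [b]P,Q \mid X \mid \mathbf{nil} \mid \mathrm{fix}\,X.P$. System terms: $W ::= P \mid \lceil c?(x).P\rceil \mid W_1\,|\,W_2 \mid \nu c{:}(n,v).W$ ($n\in\mathbb N$, $v$ closed). $x$ is bound in $P$ in both input forms, $X$ in $\mathrm{fix}\,X.P$, $c$ in $\nu c{:}(n,v).W$; terms are up to $\alpha$-conversion. In $\mathrm{fix}\,X.P$ every occurrence of $X$ in $P$ is guarded (inside a broadcast prefix, body or timeout branch of an input, a $\sigma$-prefix, or a matching branch). $\sigma^n.P$ denotes $n$ nested $\sigma$-prefixes. A channel environment $\Gamma$ maps channels to $\mathbb N\times\{\text{closed values}\}$; $\Gamma\vdash_t c:n$, $\Gamma\vdash_v c:w$ mean $\Gamma(c)=(n,w)$; $c$ is idle if $n=0$, exposed otherwise; $\Gamma[c\mapsto(n,v)]$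 is the update at $c$. $\sigma(\Gamma)(c)=(\max(t_c-1,0),v_c)$ where $\Gamma(c)=(t_c,v_c)$; $c!v(\Gamma)$ agrees with $\Gamma$ except at $c$, where it is $(\delta_v,v)$ if $c$ idle in $\Gamma$ and $(\max(\delta_v,t_c),\mathtt{err})$ if exposed; $c?v(\Gamma)=c!v(\Gamma)$; $\tau(\Gamma)=\Gamma$. $[\![e_1=e_2]\!]_\Gamma$ true iff $[\![e_1]\!]=[\![e_2]\!]$; $[\![\mathrm{exp}(c)]\!]_\Gamma$ true iff $c$ exposed in $\Gamma$. $\mathrm{rcv}(W,c)$: true for $\lfloor c?(x).P\rfloor Q$; disjunctive over $+$ and $|$; $\mathrm{rcv}(\mathrm{fix}\,X.P,c)=\mathrm{rcv}(P,c)$; $\mathrm{rcv}(\nu d{:}(n,v).W,c)=\mathrm{rcv}(W,c)$ for $d\ne c$; false otherwise. $\mathrm{rcv}(\Gamma\triangleright W,c)$ iff $c$ idle in $\Gamma$ and $\mathrm{rcv}(W,c)$. A configuration $\Gamma\triangleright W$ has $W$ closed. Intensional transitions $\Gamma\triangleright W\xrightarrow{\lambda}W'$, $\lambda\in\{c!v,c?v,\sigma,\tau\}$, form the least relation closed under: (Snd) $[\![e]\!]=v$ gives $\Gamma\triangleright c!\langle e\rangle.P\xrightarrow{c!v}\sigma^{\delta_v}.P$; (Rcv) $c$ idle gives $\Gamma\triangleright\lfloor c?(x).P\rfloor Q\xrightarrow{c?v}\lceil c?(x).P\rceil$; (RcvIgn) not $\mathrm{rcv}(\Gamma\triangleright W,c)$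 gives $\Gamma\triangleright W\xrightarrow{c?v}W$; (Sync) $W_1\xrightarrow{c!v}W_1'$, $W_2\xrightarrow{c?v}W_2'$ (under $\Gamma$) give $W_1|W_2\xrightarrow{c!v}W_1'|W_2'$, and symmetrically; (RcvPar) $W_i\xrightarrow{c?v}W_i'$ give $W_1|W_2\xrightarrow{c?v}W_1'|W_2'$; (TimeNil) $\mathbf{nil}\xrightarrow{\sigma}\mathbf{nil}$; (Sleep) $\sigma.P\xrightarrow{\sigma}P$; (ActRcv) $\Gamma\vdash_t c:n>1$ gives $\lceil c?(x).P\rceil\xrightarrow{\sigma}\lceil c?(x).P\rceil$; (EndRcv) $\Gamma\vdash_t c:1$, $\Gamma\vdash_v c:w$ give $\lceil c?(x).P\rceil\xrightarrow{\sigma}\{w/x\}P$; (Timeout) $c$ idle gives $\lfloor c?(x).P\rfloor Q\xrightarrow{\sigma}Q$; (RcvLate) $c$ exposed gives $\lfloor c?(x).P\rfloor Q\xrightarrow{\tau}\lceil c?(x).\{\mathtt{err}/x\}P\rceil$; (Tau) $\tau.P\xrightarrow{\tau}P$; (Then)/(Else) $[b]P,Q\xrightarrow{\tau}\sigma.P$ if $[\![b]\!]_\Gamma$ true, $\xrightarrow{\tau}\sigma.Q$ if false; (TimePar) $W_i\xrightarrow{\sigma}W_i'$ give $W_1|W_2\xrightarrow{\sigma}W_1'|W_2'$; (TauPar) $W_1\xrightarrow{\tau}W_1'$ gives $W_1|W_2\xrightarrow{\tau}W_1'|W_2$, and symmetrically; (Rec) $\{\mathrm{fix}\,X.P/X\}P\xrightarrow{\lambda}W$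 gives $\mathrm{fix}\,X.P\xrightarrow{\lambda}W$; (Sum) $P\xrightarrow{\lambda}W$, $\lambda\in\{\tau,c!v\}$ gives $P+Q\xrightarrow{\lambda}W$, and symmetrically; (SumTime) $P\xrightarrow{\sigma}P'$, $Q\xrightarrow{\sigma}Q'$ give $P+Q\xrightarrow{\sigma}P'+Q'$; (SumRcv) $P\xrightarrow{c?v}W$ and $\mathrm{rcv}(\Gamma\triangleright P,c)$ give $P+Q\xrightarrow{c?v}W$, and symmetrically; (ResI) $\Gamma[c\mapsto(n,v)]\triangleright W\xrightarrow{c!w}W'$ gives $\Gamma\triangleright\nu c{:}(n,v).W\xrightarrow{\tau}\nu c{:}(c!w(\Gamma[c\mapsto(n,v)])(c)).W'$; (ResV) $\Gamma[c\mapsto(n,v)]\triangleright W\xrightarrow{\lambda}W'$ with $c$ not in $\lambda$ gives $\Gamma\triangleright\nu c{:}(n,v).W\xrightarrow{\lambda}\nu c{:}(n,v).W'$. Reductions: $\Gamma\triangleright W\to\Gamma'\triangleright W'$ iff $\Gamma\triangleright W\xrightarrow{\lambda}W'$ for some $\lambda\in\{c!v,\sigma,\tau\}$ and $\Gamma'=\lambda(\Gamma)$; it is instantaneous, written $\to_i$, if $\lambda=\tau$ or $\lambda=c!v$, and timed, written $\to_\sigma$, if $\lambda=\sigma$. Well-formed configurations form the least set such that: $\Gamma\triangleright P$ is well-formed for every process $P$; $\Gamma\triangleright\lceil c?(x).P\rceil$ is well-formed if $c$ is exposed in $\Gamma$; $\Gamma\triangleright W_1|W_2$ is well-formed if $\Gamma\triangleright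 W_1$ and $\Gamma\triangleright W_2$ are; $\Gamma\triangleright\nu c{:}(n,v).W$ is well-formed if $\Gamma[c\mapsto(n,v)]\triangleright W$ is. -}

module Defs where

open import Data.Nat using (ℕ; zero; suc; _<_; _∸_; _⊔_)
open import Data.Nat.Properties using (_≟_)
open import Data.Fin using (Fin; zero; suc)
open import Data.Vec using (Vec; []; _∷_)
open import Data.Product using (_×_; _,_; proj₁; proj₂; Σ; ∃)
open import Data.Unit using (⊤)
open import Relation.Nullary using (¬_; yes; no)
open import Relation.Binary.PropositionalEquality using (_≡_; _≢_)

record Sig : Set₁ where
  field
    Val   : Set
    err   : Val
    δ     : Val → ℕ                   -- transmission time
    δ-pos : ∀ v → 0 < δ v
    Fun   : Set
    arity : Fun → ℕ
    ⟦_⟧f  : (f : Fun) → Vec Val (arity f) → Val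

module CCCP (S : Sig) where
  open Sig S

  -- Channels are de Bruijn indices (ν binds index 0).
  Chan : Set
  Chan = ℕ

  data Exp (m : ℕ) : Set where
    var : Fin m → Exp m
    con : Val → Exp m
    app : (f : Fun) → Vec (Exp m) (arity f) → Exp m

  mutual
    renE : ∀ {m n} → (Fin m → Fin n) → Exp m → Exp n
    renE ρ (var i)    = var (ρ i)
    renE ρ (con v)    = con v
    renE ρ (app f es) = app f (renEs ρ es)

    renEs : ∀ {m n k} → (Fin m → Fin n) → Vec (Exp m) k → Vec (Exp n) k
    renEs ρ []       = []
    renEs ρ (e ∷ es) = renE ρ e ∷ renEs ρ es

  mutual
    subE : ∀ {m n} → (Fin m → Exp n) → Exp m → Exp n
    subE s (var i)    = s i
    subE s (con v)    = con v
    subE s (app f es) = app f (subEs s es)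

    subEs : ∀ {m n k} → (Fin m → Exp n) → Vec (Exp m) k → Vec (Exp n) k
    subEs s []       = []
    subEs s (e ∷ es) = subE s e ∷ subEs s es

  mutual
    ⟦_⟧ : Exp 0 → Val
    ⟦ var () ⟧
    ⟦ con v ⟧    = v
    ⟦ app f es ⟧ = ⟦ f ⟧f (⟦ es ⟧s)

    ⟦_⟧s : ∀ {k} → Vec (Exp 0) k → Vec Val k
    ⟦ [] ⟧s     = []
    ⟦ e ∷ es ⟧s = ⟦ e ⟧ ∷ ⟦ es ⟧s

  data BExp (m : ℕ) : Set where
    _==_ : Exp m → Exp m → BExp m
    exp  : Chan → BExp m

  renB : ∀ {m n} → (Fin m → Fin n) → BExp m → BExp n
  renB ρ (e₁ == e₂) = renE ρ e₁ == renE ρ e₂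
  renB ρ (exp c)    = exp c

  subB : ∀ {m n} → (Fin m → Exp n) → BExp m → BExp n
  subB s (e₁ == e₂) = subE s e₁ == subE s e₂
  subB s (exp c)    = exp c

  -- Processes over m data variables and k process variables
  data Proc (m k : ℕ) : Set where
    snd   : Chan → Exp m → Proc m k → Proc m k
    inp   : Chan → Proc (suc m) k → Proc m k → Proc m k  -- ⌊c?(x).P⌋Q
    sleep : Proc m k → Proc m k
    tau   : Proc m k → Proc m k
    _⊕_   : Proc m k → Proc m k → Proc m k
    match : BExp m → Proc m k → Proc m k → Proc m k
    pvar  : Fin k → Proc m k
    nil   : Proc m k
    fix   : Proc m (suc k) → Proc m k

  liftR : ∀ {m n} → (Fin m → Fin n) → Fin (suc m) → Fin (suc n)
  liftR ρ zero    = zero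
  liftR ρ (suc i) = suc (ρ i)

  renD : ∀ {m n k} → (Fin m → Fin n) → Proc m k → Proc n k
  renD ρ (snd c e P)   = snd c (renE ρ e) (renD ρ P)
  renD ρ (inp c P Q)   = inp c (renD (liftR ρ) P) (renD ρ Q)
  renD ρ (sleep P)     = sleep (renD ρ P)
  renD ρ (tau P)       = tau (renD ρ P)
  renD ρ (P ⊕ Q)       = renD ρ P ⊕ renD ρ Q
  renD ρ (match b P Q) = match (renB ρ b) (renD ρ P) (renD ρ Q)
  renD ρ (pvar X)      = pvar X
  renD ρ nil           = nil
  renD ρ (fix P)       = fix (renD ρ P)

  liftS : ∀ {m n} → (Fin m → Exp n) → Fin (suc m) → Exp (suc n)
  liftS s zero    = var zero
  liftS s (suc i) = renE suc (s i)

  subD : ∀ {m n k} → (Fin m → Exp n) → Proc m k → Proc n k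
  subD s (snd c e P)   = snd c (subE s e) (subD s P)
  subD s (inp c P Q)   = inp c (subD (liftS s) P) (subD s Q)
  subD s (sleep P)     = sleep (subD s P)
  subD s (tau P)       = tau (subD s P)
  subD s (P ⊕ Q)       = subD s P ⊕ subD s Q
  subD s (match b P Q) = match (subB s b) (subD s P) (subD s Q)
  subD s (pvar X)      = pvar X
  subD s nil           = nil
  subD s (fix P)       = fix (subD s P)

  renP : ∀ {m k l} → (Fin k → Fin l) → Proc m k → Proc m l
  renP ρ (snd c e P)   = snd c e (renP ρ P)
  renP ρ (inp c P Q)   = inp c (renP ρ P) (renP ρ Q)
  renP ρ (sleep P)     = sleep (renP ρ P)
  renP ρ (tau P)       = tau (renP ρ P)
  renP ρ (P ⊕ Q)       = renP ρ P ⊕ renP ρ Q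
  renP ρ (match b P Q) = match b (renP ρ P) (renP ρ Q)
  renP ρ (pvar X)      = pvar (ρ X)
  renP ρ nil           = nil
  renP ρ (fix P)       = fix (renP (liftR ρ) P)

  liftP : ∀ {m k l} → (Fin k → Proc m l) → Fin (suc k) → Proc m (suc l)
  liftP s zero    = pvar zero
  liftP s (suc i) = renP suc (s i)

  subP : ∀ {m k l} → (Fin k → Proc m l) → Proc m k → Proc m l
  subP s (snd c e P)   = snd c e (subP s P)
  subP s (inp c P Q)   = inp c (subP (λ i → renD suc (s i)) P) (subP s Q)
  subP s (sleep P)     = sleep (subP s P)
  subP s (tau P)       = tau (subP s P)
  subP s (P ⊕ Q)       = subP s P ⊕ subP s Q
  subP s (match b P Q) = match b (subP s P) (subP s Q)
  subP s (pvar X)      = s X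
  subP s nil           = nil
  subP s (fix P)       = fix (subP (liftP s) P)

  _[_/x] : ∀ {m k} → Proc (suc m) k → Val → Proc m k
  P [ w /x] = subD s P
    where
      s : _ → _
      s zero    = con w
      s (suc i) = var i

  -- {w/x}P keeping the (now vacuous) binder x, as in ⌈c?(x).{err/x}P⌉
  _[_/x]′ : ∀ {m k} → Proc (suc m) k → Val → Proc (suc m) k
  P [ w /x]′ = subD s P
    where
      s : _ → _
      s zero    = con w
      s (suc i) = var (suc i)

  _[_/X] : ∀ {m k} → Proc m (suc k) → Proc m k → Proc m k
  P [ Q /X] = subP s P
    where
      s : _ → _
      s zero    = Q
      s (suc i) = pvar i

  sleepⁿ : ∀ {m k} → ℕ → Proc m k → Proc m k
  sleepⁿ zero    P = P
  sleepⁿ (suc n) P = sleep (sleepⁿ n P)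

  Guarded : ∀ {m k} → Fin k → Proc m k → Set
  Guarded i (snd c e P)   = ⊤
  Guarded i (inp c P Q)   = ⊤
  Guarded i (sleep P)     = ⊤
  Guarded i (tau P)       = Guarded i P
  Guarded i (P ⊕ Q)       = Guarded i P × Guarded i Q
  Guarded i (match b P Q) = ⊤
  Guarded i (pvar j)      = j ≢ i
  Guarded i nil           = ⊤
  Guarded i (fix P)       = Guarded (suc i) P

  Legal : ∀ {m k} → Proc m k → Set
  Legal (snd c e P)   = Legal P
  Legal (inp c P Q)   = Legal P × Legal Q
  Legal (sleep P)     = Legal P
  Legal (tau P)       = Legal P
  Legal (P ⊕ Q)       = Legal P × Legal Q
  Legal (match b P Q) = Legal P × Legal Q
  Legal (pvar X)      = ⊤
  Legal nil           = ⊤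
  Legal (fix P)       = Guarded zero P × Legal P

  data Sys : Set where
    proc   : Proc 0 0 → Sys
    active : Chan → Proc 1 0 → Sys
    _∥_    : Sys → Sys → Sys
    ν      : ℕ × Val → Sys → Sys

  LegalS : Sys → Set
  LegalS (proc P)     = Legal P
  LegalS (active c P) = Legal P
  LegalS (W₁ ∥ W₂)    = LegalS W₁ × LegalS W₂
  LegalS (ν nv W)     = LegalS W

  Env : Set
  Env = Chan → ℕ × Val

  Idle : Env → Chan → Set
  Idle Γ c = proj₁ (Γ c) ≡ 0

  Exposed : Env → Chan → Set
  Exposed Γ c = 0 < proj₁ (Γ c)

  _,,_ : Env → ℕ × Val → Env
  (Γ ,, nv) zero    = nv
  (Γ ,, nv) (suc c) = Γ c

  σΓ : Env → Env
  σΓ Γ c = proj₁ (Γ c) ∸ 1 , proj₂ (Γ c)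

  sendEntry : Val → ℕ × Val → ℕ × Val
  sendEntry v (zero  , w) = δ v , v
  sendEntry v (suc t , w) = δ v ⊔ suc t , err

  sndΓ : Chan → Val → Env → Env
  sndΓ c v Γ d with d ≟ c
  ... | yes _ = sendEntry v (Γ c)
  ... | no  _ = Γ d

  ⟦_⟧b_ : BExp 0 → Env → Set
  ⟦ e₁ == e₂ ⟧b Γ = ⟦ e₁ ⟧ ≡ ⟦ e₂ ⟧
  ⟦ exp c ⟧b Γ    = Exposed Γ c

  data Lab : Set where
    _!_ : Chan → Val → Lab
    _¿_ : Chan → Val → Lab
    σ   : Lab
    τ   : Lab

  updΓ : Lab → Env → Env
  updΓ (c ! v) Γ = sndΓ c v Γ
  updΓ (c ¿ v) Γ = sndΓ c v Γ
  updΓ σ       Γ = σΓ Γ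
  updΓ τ       Γ = Γ

  -- a label seen from inside ν (channel indices shifted by one);
  -- these are exactly the labels in which the bound channel 0 does not occur
  upL : Lab → Lab
  upL (c ! v) = suc c ! v
  upL (c ¿ v) = suc c ¿ v
  upL σ       = σ
  upL τ       = τ

  data RcvP {m k : ℕ} : Proc m k → Chan → Set where
    r-inp  : ∀ {c P Q} → RcvP (inp c P Q) c
    r-sumˡ : ∀ {P Q c} → RcvP P c → RcvP (P ⊕ Q) c
    r-sumʳ : ∀ {P Q c} → RcvP Q c → RcvP (P ⊕ Q) c
    r-fix  : ∀ {P c} → RcvP P c → RcvP (fix P) c

  data RcvS : Sys → Chan → Set where
    r-proc : ∀ {P c} → RcvP P c → RcvS (proc P) c
    r-parˡ : ∀ {W₁ W₂ c} → RcvS W₁ c → RcvS (W₁ ∥ W₂) c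
    r-parʳ : ∀ {W₁ W₂ c} → RcvS W₂ c → RcvS (W₁ ∥ W₂) c
    r-ν    : ∀ {nv W c} → RcvS W (suc c) → RcvS (ν nv W) c

  Rcv : Env → Sys → Chan → Set
  Rcv Γ W c = Idle Γ c × RcvS W c

  data _▷_—[_]→_ (Γ : Env) : Sys → Lab → Sys → Set where
    Snd     : ∀ {c e P v} → ⟦ e ⟧ ≡ v →
              Γ ▷ proc (snd c e P) —[ c ! v ]→ proc (sleepⁿ (δ v) P)
    Rcv-    : ∀ {c P Q v} → Idle Γ c →
              Γ ▷ proc (inp c P Q) —[ c ¿ v ]→ active c P
    RcvIgn  : ∀ {W c v} → ¬ Rcv Γ W c → Γ ▷ W —[ c ¿ v ]→ W
    SyncL   : ∀ {W₁ W₂ W₁' W₂' c v} →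
              Γ ▷ W₁ —[ c ! v ]→ W₁' → Γ ▷ W₂ —[ c ¿ v ]→ W₂' →
              Γ ▷ (W₁ ∥ W₂) —[ c ! v ]→ (W₁' ∥ W₂')
    SyncR   : ∀ {W₁ W₂ W₁' W₂' c v} →
              Γ ▷ W₁ —[ c ¿ v ]→ W₁' → Γ ▷ W₂ —[ c ! v ]→ W₂' →
              Γ ▷ (W₁ ∥ W₂) —[ c ! v ]→ (W₁' ∥ W₂')
    RcvPar  : ∀ {W₁ W₂ W₁' W₂' c v} →
              Γ ▷ W₁ —[ c ¿ v ]→ W₁' → Γ ▷ W₂ —[ c ¿ v ]→ W₂' →
              Γ ▷ (W₁ ∥ W₂) —[ c ¿ v ]→ (W₁' ∥ W₂')
    TimeNil : Γ ▷ proc nil —[ σ ]→ proc nil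
    Sleep   : ∀ {P} → Γ ▷ proc (sleep P) —[ σ ]→ proc P
    ActRcv  : ∀ {c P} → 1 < proj₁ (Γ c) →
              Γ ▷ active c P —[ σ ]→ active c P
    EndRcv  : ∀ {c P w} → Γ c ≡ (1 , w) →
              Γ ▷ active c P —[ σ ]→ proc (P [ w /x])
    Timeout : ∀ {c P Q} → Idle Γ c →
              Γ ▷ proc (inp c P Q) —[ σ ]→ proc Q
    RcvLate : ∀ {c P Q} → Exposed Γ c →
              Γ ▷ proc (inp c P Q) —[ τ ]→ active c (P [ err /x]′)
    Tau     : ∀ {P} → Γ ▷ proc (tau P) —[ τ ]→ proc P
    Then    : ∀ {b P Q} → ⟦ b ⟧b Γ →
              Γ ▷ proc (match b P Q) —[ τ ]→ proc (sleep P)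
    Else    : ∀ {b P Q} → ¬ (⟦ b ⟧b Γ) →
              Γ ▷ proc (match b P Q) —[ τ ]→ proc (sleep Q)
    TimePar : ∀ {W₁ W₂ W₁' W₂'} →
              Γ ▷ W₁ —[ σ ]→ W₁' → Γ ▷ W₂ —[ σ ]→ W₂' →
              Γ ▷ (W₁ ∥ W₂) —[ σ ]→ (W₁' ∥ W₂')
    TauParL : ∀ {W₁ W₂ W₁'} → Γ ▷ W₁ —[ τ ]→ W₁' →
              Γ ▷ (W₁ ∥ W₂) —[ τ ]→ (W₁' ∥ W₂)
    TauParR : ∀ {W₁ W₂ W₂'} → Γ ▷ W₂ —[ τ ]→ W₂' →
              Γ ▷ (W₁ ∥ W₂) —[ τ ]→ (W₁ ∥ W₂')
    Rec     : ∀ {P λ' W} → Γ ▷ proc (P [ fix P /X]) —[ λ' ]→ W →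
              Γ ▷ proc (fix P) —[ λ' ]→ W
    SumTauL : ∀ {P Q W} → Γ ▷ proc P —[ τ ]→ W → Γ ▷ proc (P ⊕ Q) —[ τ ]→ W
    SumTauR : ∀ {P Q W} → Γ ▷ proc Q —[ τ ]→ W → Γ ▷ proc (P ⊕ Q) —[ τ ]→ W
    SumSndL : ∀ {P Q W c v} → Γ ▷ proc P —[ c ! v ]→ W →
              Γ ▷ proc (P ⊕ Q) —[ c ! v ]→ W
    SumSndR : ∀ {P Q W c v} → Γ ▷ proc Q —[ c ! v ]→ W →
              Γ ▷ proc (P ⊕ Q) —[ c ! v ]→ W
    SumTime : ∀ {P Q P' Q'} →
              Γ ▷ proc P —[ σ ]→ proc P' → Γ ▷ proc Q —[ σ ]→ proc Q' →
              Γ ▷ proc (P ⊕ Q) —[ σ ]→ proc (P' ⊕ Q')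
    SumRcvL : ∀ {P Q W c v} → Γ ▷ proc P —[ c ¿ v ]→ W → Rcv Γ (proc P) c →
              Γ ▷ proc (P ⊕ Q) —[ c ¿ v ]→ W
    SumRcvR : ∀ {P Q W c v} → Γ ▷ proc Q —[ c ¿ v ]→ W → Rcv Γ (proc Q) c →
              Γ ▷ proc (P ⊕ Q) —[ c ¿ v ]→ W
    ResI    : ∀ {nv W W' w} → (Γ ,, nv) ▷ W —[ zero ! w ]→ W' →
              Γ ▷ ν nv W —[ τ ]→ ν (sndΓ zero w (Γ ,, nv) zero) W'
    ResV    : ∀ {nv W W' λ'} → (Γ ,, nv) ▷ W —[ upL λ' ]→ W' →
              Γ ▷ ν nv W —[ λ' ]→ ν nv W'

  record Conf : Set where
    constructor _▷_
    field
      env  : Env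
      term : Sys

  data _⟶ᵢ_ : Conf → Conf → Set where
    red-τ : ∀ {Γ W W'} → Γ ▷ W —[ τ ]→ W' → (Γ ▷ W) ⟶ᵢ (updΓ τ Γ ▷ W')
    red-! : ∀ {Γ W W' c v} → Γ ▷ W —[ c ! v ]→ W' →
            (Γ ▷ W) ⟶ᵢ (updΓ (c ! v) Γ ▷ W')

  data _⟶σ_ : Conf → Conf → Set where
    red-σ : ∀ {Γ W W'} → Γ ▷ W —[ σ ]→ W' → (Γ ▷ W) ⟶σ (updΓ σ Γ ▷ W')

  data WF : Conf → Set where
    wf-proc   : ∀ {Γ P} → WF (Γ ▷ proc P)
    wf-active : ∀ {Γ c P} → Exposed Γ c → WF (Γ ▷ active c P)
    wf-par    : ∀ {Γ W₁ W₂} → WF (Γ ▷ W₁) → WF (Γ ▷ W₂) → WF (Γ ▷ (W₁ ∥ W₂))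
    wf-ν      : ∀ {Γ nv W} → WF ((Γ ,, nv) ▷ W) → WF (Γ ▷ ν nv W)

module Submission where

-- The proof is a structural induction on the system term.  A parallel
-- composition is quiescent only if each component is, because a component
-- that could broadcast would synchronise with the other one: every system
-- can perform every input c?v (input-enabledness, proved constructively
-- from the decidability of rcv).  Restriction extends the environment, and
-- an active receiver on an exposed channel steps by ActRcv or EndRcv.
--
-- The heart is the case of a closed process.  A quiescent process steps in
-- time by induction on its top size (the number of top-level sums and
-- recursions); unfolding fix X.P does not change the top size because X is
-- guarded in P.  Hence the file first develops guardedness, top size and
-- top-level legality under renaming and substitution of process variables,
-- then input-enabledness, then the two progress lemmas, and finally the
-- theorem.

open import Defs
open import Data.Product using (∃; Σ; _×_; _,_; proj₁; proj₂)
open import Data.Nat using (ℕ; zero; suc; _+_; _<_; z≤n; s≤s)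
open import Data.Nat.Properties using (_≟_; ≤-refl; ≤-trans; m≤m+n; m≤n+m; n≮0)
  renaming (suc-injective to ℕ-suc-injective)
open import Data.Fin using (Fin; zero; suc)
open import Data.Fin.Properties using (suc-injective)
open import Data.Sum using (_⊎_; inj₁; inj₂; [_,_]; map₁; map₂)
open import Data.Unit using (⊤; tt)
open import Data.Empty using (⊥-elim)
open import Relation.Nullary using (¬_; Dec; yes; no)
open import Relation.Nullary.Decidable using (map′; _×-dec_; _⊎-dec_)
open import Relation.Binary.PropositionalEquality
  using (_≡_; refl; sym; trans; cong; cong₂; subst)

module TimeProgress (S : Sig) where
  open Sig S
  open CCCP S

  guarded-renP : ∀ {m k l} (ρ : Fin k → Fin l) {i : Fin l} (P : Proc m k) →
                 (∀ j → ρ j ≡ i → Guarded j P) → Guarded i (renP ρ P)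
  guarded-renP ρ (snd c e P)   h = tt
  guarded-renP ρ (inp c P Q)   h = tt
  guarded-renP ρ (sleep P)     h = tt
  guarded-renP ρ (tau P)       h = guarded-renP ρ P h
  guarded-renP ρ (P ⊕ Q)       h =
    guarded-renP ρ P (λ j e → proj₁ (h j e)) , guarded-renP ρ Q (λ j e → proj₂ (h j e))
  guarded-renP ρ (match b P Q) h = tt
  guarded-renP ρ (pvar X)      h = λ e → h X e refl
  guarded-renP ρ nil           h = tt
  guarded-renP ρ (fix P)       h = guarded-renP (liftR ρ) P lifted
    where
      lifted : ∀ j → liftR ρ j ≡ suc _ → Guarded j P
      lifted zero    ()
      lifted (suc j) e = h j (suc-injective e)

  guarded-weaken : ∀ {m k} {i : Fin k} (P : Proc m k) →
                   Guarded i P → Guarded (suc i) (renP suc P)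
  guarded-weaken P g = guarded-renP suc P (λ j e → subst (λ x → Guarded x P) (sym (suc-injective e)) g)

  fresh-guarded : ∀ {m k} (P : Proc m k) → Guarded zero (renP suc P)
  fresh-guarded P = guarded-renP suc P (λ j ())

  guarded-subP : ∀ {m k l} (s : Fin k → Proc m l) {i : Fin l} (P : Proc m k) →
                 (∀ j → Guarded j P ⊎ Guarded i (s j)) → Guarded i (subP s P)
  guarded-subP s (snd c e P)   h = tt
  guarded-subP s (inp c P Q)   h = tt
  guarded-subP s (sleep P)     h = tt
  guarded-subP s (tau P)       h = guarded-subP s P h
  guarded-subP s (P ⊕ Q)       h =
    guarded-subP s P (λ j → map₁ proj₁ (h j)) , guarded-subP s Q (λ j → map₁ proj₂ (h j))
  guarded-subP s (match b P Q) h = tt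
  guarded-subP s (pvar X)      h with h X
  ... | inj₁ g = ⊥-elim (g refl)
  ... | inj₂ g = g
  guarded-subP s nil           h = tt
  guarded-subP s (fix P)       h = guarded-subP (liftP s) P lifted
    where
      lifted : ∀ j → Guarded j P ⊎ Guarded (suc _) (liftP s j)
      lifted zero    = inj₂ (λ ())
      lifted (suc j) = map₂ (guarded-weaken (s j)) (h j)

  -- The top size counts the sums and recursions above the first prefix,
  -- match, variable or nil; the timed step of a process recurses on it.
  topSize : ∀ {m k} → Proc m k → ℕ
  topSize (P ⊕ Q) = suc (topSize P + topSize Q)
  topSize (fix P) = suc (topSize P)
  topSize _       = 1

  topSize-renP : ∀ {m k l} (ρ : Fin k → Fin l) (P : Proc m k) →
                 topSize (renP ρ P) ≡ topSize P
  topSize-renP ρ (snd c e P)   = refl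
  topSize-renP ρ (inp c P Q)   = refl
  topSize-renP ρ (sleep P)     = refl
  topSize-renP ρ (tau P)       = refl
  topSize-renP ρ (P ⊕ Q)       =
    cong₂ (λ a b → suc (a + b)) (topSize-renP ρ P) (topSize-renP ρ Q)
  topSize-renP ρ (match b P Q) = refl
  topSize-renP ρ (pvar X)      = refl
  topSize-renP ρ nil           = refl
  topSize-renP ρ (fix P)       = cong suc (topSize-renP (liftR ρ) P)

  -- Substituting terms of top size 1 for the unguarded variables does not
  -- change the top size (guarded variables sit below the counted layer).
  topSize-subP : ∀ {m k l} (s : Fin k → Proc m l) (P : Proc m k) →
                 (∀ j → Guarded j P ⊎ topSize (s j) ≡ 1) →
                 topSize (subP s P) ≡ topSize P
  topSize-subP s (snd c e P)   h = refl
  topSize-subP s (inp c P Q)   h = refl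
  topSize-subP s (sleep P)     h = refl
  topSize-subP s (tau P)       h = refl
  topSize-subP s (P ⊕ Q)       h =
    cong₂ (λ a b → suc (a + b)) (topSize-subP s P (λ j → map₁ proj₁ (h j)))
                                (topSize-subP s Q (λ j → map₁ proj₂ (h j)))
  topSize-subP s (match b P Q) h = refl
  topSize-subP s (pvar X)      h with h X
  ... | inj₁ g = ⊥-elim (g refl)
  ... | inj₂ e = e
  topSize-subP s nil           h = refl
  topSize-subP s (fix P)       h = cong suc (topSize-subP (liftP s) P lifted)
    where
      lifted : ∀ j → Guarded j P ⊎ topSize (liftP s j) ≡ 1
      lifted zero    = inj₂ refl
      lifted (suc j) = map₂ (trans (topSize-renP suc (s j))) (h j)

  -- Unlike Legal it is preserved by
  -- substitution without having to look under input binders.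
  TopLegal : ∀ {m k} → Proc m k → Set
  TopLegal (P ⊕ Q) = TopLegal P × TopLegal Q
  TopLegal (fix P) = Guarded zero P × TopLegal P
  TopLegal _       = ⊤

  legal⇒topLegal : ∀ {m k} (P : Proc m k) → Legal P → TopLegal P
  legal⇒topLegal (snd c e P)   l        = tt
  legal⇒topLegal (inp c P Q)   l        = tt
  legal⇒topLegal (sleep P)     l        = tt
  legal⇒topLegal (tau P)       l        = tt
  legal⇒topLegal (P ⊕ Q)       (l , l′) = legal⇒topLegal P l , legal⇒topLegal Q l′
  legal⇒topLegal (match b P Q) l        = tt
  legal⇒topLegal (pvar X)      l        = tt
  legal⇒topLegal nil           l        = tt
  legal⇒topLegal (fix P)       (g , l)  = g , legal⇒topLegal P l

  topLegal-renP : ∀ {m k l} (ρ : Fin k → Fin l) (P : Proc m k) →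
                  TopLegal P → TopLegal (renP ρ P)
  topLegal-renP ρ (snd c e P)   t        = tt
  topLegal-renP ρ (inp c P Q)   t        = tt
  topLegal-renP ρ (sleep P)     t        = tt
  topLegal-renP ρ (tau P)       t        = tt
  topLegal-renP ρ (P ⊕ Q)       (t , t′) = topLegal-renP ρ P t , topLegal-renP ρ Q t′
  topLegal-renP ρ (match b P Q) t        = tt
  topLegal-renP ρ (pvar X)      t        = tt
  topLegal-renP ρ nil           t        = tt
  topLegal-renP ρ (fix P)       (g , t)  =
    guarded-renP (liftR ρ) P (λ { zero _ → g ; (suc j) () }) , topLegal-renP (liftR ρ) P t

  topLegal-subP : ∀ {m k l} (s : Fin k → Proc m l) (P : Proc m k) →
                  TopLegal P → (∀ j → TopLegal (s j)) → TopLegal (subP s P)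
  topLegal-subP s (snd c e P)   t        ts = tt
  topLegal-subP s (inp c P Q)   t        ts = tt
  topLegal-subP s (sleep P)     t        ts = tt
  topLegal-subP s (tau P)       t        ts = tt
  topLegal-subP s (P ⊕ Q)       (t , t′) ts = topLegal-subP s P t ts , topLegal-subP s Q t′ ts
  topLegal-subP s (match b P Q) t        ts = tt
  topLegal-subP s (pvar X)      t        ts = ts X
  topLegal-subP s nil           t        ts = tt
  topLegal-subP s (fix P)       (g , t)  ts =
    guarded-subP (liftP s) P bound-guarded , topLegal-subP (liftP s) P t lifted
    where
      bound-guarded : ∀ j → Guarded j P ⊎ Guarded zero (liftP s j)
      bound-guarded zero    = inj₁ g
      bound-guarded (suc j) = inj₂ (fresh-guarded (s j))
      lifted : ∀ j → TopLegal (liftP s j)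
      lifted zero    = tt
      lifted (suc j) = topLegal-renP suc (s j) (ts j)

  topSize-unfold : ∀ {m k} (P : Proc m (suc k)) → Guarded zero P →
                   topSize (P [ fix P /X]) ≡ topSize P
  topSize-unfold P g = topSize-subP _ P λ { zero → inj₁ g ; (suc j) → inj₂ refl }

  topLegal-unfold : ∀ {m k} (P : Proc m (suc k)) → TopLegal (fix P) →
                    TopLegal (P [ fix P /X])
  topLegal-unfold P (g , t) = topLegal-subP _ P t λ { zero → g , t ; (suc j) → tt }

  -- Input-enabledness.  rcv is decidable, and every configuration can
  -- perform every input c?v: by RcvIgn when rcv fails, otherwise by
  -- following the receiving summand.
  rcvP? : ∀ {m k} (P : Proc m k) c → Dec (RcvP P c)
  rcvP? (inp d P Q)   c with d ≟ c
  ... | yes refl = yes r-inp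
  ... | no  d≢c  = no λ { r-inp → d≢c refl }
  rcvP? (P ⊕ Q)       c = map′ [ r-sumˡ , r-sumʳ ] from-sum (rcvP? P c ⊎-dec rcvP? Q c)
    where
      from-sum : RcvP (P ⊕ Q) c → RcvP P c ⊎ RcvP Q c
      from-sum (r-sumˡ r) = inj₁ r
      from-sum (r-sumʳ r) = inj₂ r
  rcvP? (fix P)       c = map′ r-fix (λ { (r-fix r) → r }) (rcvP? P c)
  rcvP? (snd d e P)   c = no λ ()
  rcvP? (sleep P)     c = no λ ()
  rcvP? (tau P)       c = no λ ()
  rcvP? (match b P Q) c = no λ ()
  rcvP? (pvar X)      c = no λ ()
  rcvP? nil           c = no λ ()

  rcvS? : ∀ W c → Dec (RcvS W c)
  rcvS? (proc P)     c = map′ r-proc (λ { (r-proc r) → r }) (rcvP? P c)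
  rcvS? (active d P) c = no λ ()
  rcvS? (W₁ ∥ W₂)    c = map′ [ r-parˡ , r-parʳ ] from-par (rcvS? W₁ c ⊎-dec rcvS? W₂ c)
    where
      from-par : RcvS (W₁ ∥ W₂) c → RcvS W₁ c ⊎ RcvS W₂ c
      from-par (r-parˡ r) = inj₁ r
      from-par (r-parʳ r) = inj₂ r
  rcvS? (ν nv W)     c = map′ r-ν (λ { (r-ν r) → r }) (rcvS? W (suc c))

  rcv? : ∀ Γ W c → Dec (Rcv Γ W c)
  rcv? Γ W c = (proj₁ (Γ c) ≟ 0) ×-dec rcvS? W c

  -- Substitution of process
  -- variables preserves derivations together with their depth, which makes
  -- the depth a measure that survives unfolding.
  rcvDepth : ∀ {m k} {P : Proc m k} {c} → RcvP P c → ℕ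
  rcvDepth r-inp      = 0
  rcvDepth (r-sumˡ r) = suc (rcvDepth r)
  rcvDepth (r-sumʳ r) = suc (rcvDepth r)
  rcvDepth (r-fix r)  = suc (rcvDepth r)

  rcvP-subP : ∀ {m k l c} (s : Fin k → Proc m l) {P : Proc m k} (r : RcvP P c) →
              Σ (RcvP (subP s P) c) λ r′ → rcvDepth r′ ≡ rcvDepth r
  rcvP-subP s r-inp      = r-inp , refl
  rcvP-subP s (r-sumˡ r) = let (r′ , e) = rcvP-subP s r in r-sumˡ r′ , cong suc e
  rcvP-subP s (r-sumʳ r) = let (r′ , e) = rcvP-subP s r in r-sumʳ r′ , cong suc e
  rcvP-subP s (r-fix r)  = let (r′ , e) = rcvP-subP (liftP s) r in r-fix r′ , cong suc e

  receiveP : ∀ Γ {c} v {P : Proc 0 0} (r : RcvP P c) n → rcvDepth r ≡ n → Idle Γ c →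
             ∃ λ W → Γ ▷ proc P —[ c ¿ v ]→ W
  receiveP Γ v r-inp            _       _ idle = _ , Rcv- idle
  receiveP Γ v (r-sumˡ r)       (suc n) e idle =
    let (W , step) = receiveP Γ v r n (ℕ-suc-injective e) idle in W , SumRcvL step (idle , r-proc r)
  receiveP Γ v (r-sumʳ r)       (suc n) e idle =
    let (W , step) = receiveP Γ v r n (ℕ-suc-injective e) idle in W , SumRcvR step (idle , r-proc r)
  receiveP Γ v (r-fix {P} r)    (suc n) e idle =
    let (r′ , e′)  = rcvP-subP _ {P} r
        (W , step) = receiveP Γ v {P [ fix P /X]} r′ n (trans e′ (ℕ-suc-injective e)) idle
    in W , Rec step

  mutual
    receive : ∀ Γ W c v → ∃ λ W′ → Γ ▷ W —[ c ¿ v ]→ W′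
    receive Γ W c v with rcv? Γ W c
    ... | no  ¬rcv        = W , RcvIgn ¬rcv
    ... | yes (idle , r)  = receiveS Γ W v idle r

    receiveS : ∀ Γ W {c} v → Idle Γ c → RcvS W c → ∃ λ W′ → Γ ▷ W —[ c ¿ v ]→ W′
    receiveS Γ (proc P)  v idle (r-proc r) =
      let (W′ , step) = receiveP Γ v r _ refl idle in W′ , step
    receiveS Γ (W₁ ∥ W₂) {c} v idle (r-parˡ r) =
      let (W₁′ , step₁) = receiveS Γ W₁ v idle r
          (W₂′ , step₂) = receive Γ W₂ c v
      in W₁′ ∥ W₂′ , RcvPar step₁ step₂
    receiveS Γ (W₁ ∥ W₂) {c} v idle (r-parʳ r) =
      let (W₁′ , step₁) = receive Γ W₁ c v
          (W₂′ , step₂) = receiveS Γ W₂ v idle r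
      in W₁′ ∥ W₂′ , RcvPar step₁ step₂
    receiveS Γ (ν nv W)  {c} v idle (r-ν r) =
      let (W′ , step) = receiveS (Γ ,, nv) W v idle r in ν nv W′ , ResV {λ' = c ¿ v} step

  Quiescent : Env → Sys → Set
  Quiescent Γ W = (∀ {W′} → ¬ Γ ▷ W —[ τ ]→ W′)
                × (∀ {W′ c v} → ¬ Γ ▷ W —[ c ! v ]→ W′)

  irreducible⇒quiescent : ∀ {Γ W} → ¬ (∃ λ C′ → (Γ ▷ W) ⟶ᵢ C′) → Quiescent Γ W
  irreducible⇒quiescent no-instant =
    (λ t → no-instant (_ , red-τ t)) , (λ t → no-instant (_ , red-! t))

  -- Broadcasts, τ-prefixes, matches and
  -- late inputs are excluded by quiescence (a match always has a τ-step,
  -- since either Then or Else applies).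
  processTick : ∀ Γ n (P : Proc 0 0) → topSize P < n → TopLegal P → Quiescent Γ (proc P) →
                ∃ λ P′ → Γ ▷ proc P —[ σ ]→ proc P′
  processTick Γ (suc n) (snd c e P)   _ _ (no-τ , no-!) = ⊥-elim (no-! (Snd refl))
  processTick Γ (suc n) (inp c P Q)   _ _ (no-τ , no-!) with proj₁ (Γ c) in eq
  ... | zero  = Q , Timeout eq
  ... | suc t = ⊥-elim (no-τ (RcvLate (subst (0 <_) (sym eq) (s≤s z≤n))))
  processTick Γ (suc n) (sleep P)     _ _ _             = P , Sleep
  processTick Γ (suc n) (tau P)       _ _ (no-τ , no-!) = ⊥-elim (no-τ Tau)
  processTick Γ (suc n) (P ⊕ Q) (s≤s size) (tP , tQ) (no-τ , no-!) =
    let (P′ , stepP) = processTick Γ n P (≤-trans (s≤s (m≤m+n (topSize P) (topSize Q))) size) tP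
                         ((λ t → no-τ (SumTauL t)) , (λ t → no-! (SumSndL t)))
        (Q′ , stepQ) = processTick Γ n Q (≤-trans (s≤s (m≤n+m (topSize Q) (topSize P))) size) tQ
                         ((λ t → no-τ (SumTauR t)) , (λ t → no-! (SumSndR t)))
    in P′ ⊕ Q′ , SumTime stepP stepQ
  processTick Γ (suc n) (match b P Q) _ _ (no-τ , no-!) =
    ⊥-elim (no-τ (Else λ b-holds → no-τ (Then b-holds)))
  processTick Γ (suc n) (pvar ())     _ _ _
  processTick Γ (suc n) nil           _ _ _             = nil , TimeNil
  processTick Γ (suc n) (fix P) (s≤s size) (g , t) (no-τ , no-!) =
    let (P′ , step) = processTick Γ n (P [ fix P /X])
                        (subst (_< n) (sym (topSize-unfold P g)) size)
                        (topLegal-unfold P (g , t))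
                        ((λ s → no-τ (Rec s)) , (λ s → no-! (Rec s)))
    in P′ , Rec step

  -- A broadcast of
  -- one parallel component would synchronise with the input of the other,
  -- so each component is quiescent; inside ν, a broadcast on the bound
  -- channel would be a τ-step of the restriction (ResI).
  systemTick : ∀ Γ W → WF (Γ ▷ W) → LegalS W → Quiescent Γ W →
               ∃ λ W′ → Γ ▷ W —[ σ ]→ W′
  systemTick Γ (proc P) wf l quiet =
    let (P′ , step) = processTick Γ _ P ≤-refl (legal⇒topLegal P l) quiet in proc P′ , step
  systemTick Γ (active c P) (wf-active exposed) l quiet with Γ c in eq
  ... | zero , w          = ⊥-elim (n≮0 exposed)
  ... | suc zero , w      = proc (P [ w /x]) , EndRcv eq
  ... | suc (suc t) , w   = active c P , ActRcv (subst (λ e → 1 < proj₁ e) (sym eq) (s≤s (s≤s z≤n)))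
  systemTick Γ (W₁ ∥ W₂) (wf-par wf₁ wf₂) (l₁ , l₂) (no-τ , no-!) =
    let (W₁′ , step₁) = systemTick Γ W₁ wf₁ l₁
          ((λ t → no-τ (TauParL t)) , (λ {_} {c} {v} t → no-! (SyncL t (proj₂ (receive Γ W₂ c v)))))
        (W₂′ , step₂) = systemTick Γ W₂ wf₂ l₂
          ((λ t → no-τ (TauParR t)) , (λ {_} {c} {v} t → no-! (SyncR (proj₂ (receive Γ W₁ c v)) t)))
    in W₁′ ∥ W₂′ , TimePar step₁ step₂
  systemTick Γ (ν nv W) (wf-ν wf) l (no-τ , no-!) =
    let (W′ , step) = systemTick (Γ ,, nv) W wf l ((λ t → no-τ (ResV {λ' = τ} t)) , no-!-inside)
    in ν nv W′ , ResV {λ' = σ} step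
    where
      no-!-inside : ∀ {W′ c v} → ¬ (Γ ,, nv) ▷ W —[ c ! v ]→ W′
      no-!-inside {c = zero}        t = no-τ (ResI t)
      no-!-inside {c = suc c} {v}   t = no-! (ResV {λ' = c ! v} t)

open CCCP using (_▷_; red-σ)
open TimeProgress using (irreducible⇒quiescent; systemTick)

mainTheorem12 : (S : Sig) → let open CCCP S in
    (C : Conf) → LegalS (Conf.term C) → WF C →
    ¬ (∃ λ C' → C ⟶ᵢ C') →
    ∃ λ C'' → C ⟶σ C''
mainTheorem12 S (Γ ▷ W) legal wf no-instant =
  let (W′ , step) = systemTick S Γ W wf legal (irreducible⇒quiescent S no-instant)
  in _ , red-σ step
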